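{- Let $p \in \mathrm{PF}(G)$ be a $G$-parking function, and $(A, B)$ an ordered set partition of $\tilde{V}$ with $A, B \neq \emptyset$. Then $p$ is decomposable with respect to $(A, B)$ if and only if $p^A \in \mathrm{PF}(G^A)$ and $p^B(v) > 0$ for all $v \in B$.
   Context: Let $G = (\Gamma, s)$ be a finite, connected, undirected graph (multiple edges allowed, no loops) with vertex set $V$, rooted at a sink vertex $s$, and let $\tilde{V} := V \setminus \{s\}$. For $v, w \in V$, $\mathrm{mult}(vw)$ is the number of edges between $v$ and $w$; for $A \subseteq V$, $\deg^A(v) := \sum_{w \in A} \mathrm{mult}(vw)$. A function $p : \tilde{V} \to \mathbb{N}$ (positive integers) is a $G$-parking function if for every non-empty $S \subseteq \tilde{V}$ there exists $v \in S$ with $p(v) \leq \deg^{V \setminus S}(v)$; $\mathrm{PF}(G)$ denotes the set of $G$-parking functions. For $A \subseteq \tilde{V}$, $G^A$ denotes the induced subgraph of $G$ on $A \cup \{s\}$, rooted at $s$. For an ordered set partition $(A,B)$ of $\tilde{V}$ with $A, B$ non-empty and $p \in \mathrm{PF}(G)$, define $p^A : A \to \mathbb{N}$ by $p^A(v) := p(v)$ for $v \in A$, and $p^B : B \to \mathbb{Z}$ by $p^B(v) := p(v) - \deg^A(v)$ for $v \in B$. Then $p$ is called decomposable with respect to $(A,B)$ if $p^A \in \mathrm{PF}(G^A)$ and $p^B \in \mathrm{PF}(G^B)$. -}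

module Defs where

open import Data.Nat as ℕ using (ℕ; zero; suc)
open import Data.Integer as ℤ using (ℤ; +_; _-_)
open import Data.Bool using (Bool; true; false; if_then_else_)
open import Data.Fin using (Fin; zero; suc)
open import Data.Fin.Subset using (Subset; inside; outside; _∈_; _⊆_; _─_; Nonempty)
open import Data.Vec using (Vec; _∷_; lookup; tabulate; sum)
open import Data.Product using (_×_; ∃; _,_)
open import Relation.Binary.PropositionalEquality using (_≡_)
open import Relation.Nullary using (¬_)
open import Data.Sum using (_⊎_)

-- A multigraph on the vertex set V = Fin (suc n); the sink s is the vertex zero,
-- and the non-sink vertices Ṽ are identified with Fin n via suc.
-- mult v w = number of edges between v and w.
Mult : ℕ → Set
Mult n = Fin (suc n) → Fin (suc n) → ℕ

Symmetric : ∀ {n} → Mult n → Set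
Symmetric mult = ∀ v w → mult v w ≡ mult w v

Loopless : ∀ {n} → Mult n → Set
Loopless mult = ∀ v → mult v v ≡ 0

data Reach {n} (mult : Mult n) (u : Fin (suc n)) : Fin (suc n) → Set where
  here : Reach mult u u
  step : ∀ {v w} → Reach mult u v → 0 ℕ.< mult v w → Reach mult u w

Connected : ∀ {n} → Mult n → Set
Connected mult = ∀ u v → Reach mult u v

deg : ∀ {n} → Mult n → Fin (suc n) → Subset (suc n) → ℕ
deg mult v X = sum (tabulate λ w → if lookup X w then mult v w else 0)

withSink : ∀ {n} → Subset n → Subset (suc n)
withSink A = inside ∷ A

withoutSink : ∀ {n} → Subset n → Subset (suc n)
withoutSink A = outside ∷ A

-- p is a parking function of the induced subgraph G^W on W ∪ {s} (rooted at s),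
-- for W ⊆ Ṽ.  Only the values of p on W matter.  Values are integers; the
-- requirement that a parking function takes values in the positive integers is
-- the first component.
IsPF : ∀ {n} → Mult n → Subset n → (Fin n → ℤ) → Set
IsPF mult W p =
  (∀ v → v ∈ W → + 1 ℤ.≤ p v) ×
  (∀ (S : Subset n) → S ⊆ W → Nonempty S →
     ∃ λ v → v ∈ S × p v ℤ.≤ + deg mult (suc v) (withSink (W ─ S)))
  where n = _

IsPFG : ∀ {n} → Mult n → (Fin n → ℤ) → Set
IsPFG mult p = IsPF mult Data.Fin.Subset.⊤ p

pB : ∀ {n} → Mult n → (Fin n → ℤ) → Subset n → Fin n → ℤ
pB mult p A v = p v - + deg mult (suc v) (withoutSink A)

IsPartition : ∀ {n} → Subset n → Subset n → Set
IsPartition {n} A B = ∀ (v : Fin n) → (v ∈ A × ¬ (v ∈ B)) ⊎ (¬ (v ∈ A) × v ∈ B)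

Decomposable : ∀ {n} → Mult n → (Fin n → ℤ) → Subset n → Subset n → Set
Decomposable mult p A B = IsPF mult A p × IsPF mult B (pB mult p A)

-- For S ⊆ B the vertices outside S split as V ∖ S = A ⊔ ((B ∖ S) ∪ {s}), so
-- deg^{V∖S}(v) = deg^A(v) + deg^{(B∖S)∪{s}}(v).  Subtracting deg^A(v), the parking
-- condition of p on S in G becomes exactly that of p^B on S in G^B; hence only the
-- positivity of p^B can fail.
module Submission where

open import Defs
open import Data.Nat using (ℕ)
open import Data.Integer using (ℤ; +_; _<_)
open import Data.Fin using (Fin)
open import Data.Fin.Subset using (Subset; _∈_; Nonempty)
open import Function.Bundles using (_⇔_)
open import Data.Product using (_×_)

import Data.Integer.Properties as ℤ
import Data.Nat as ℕ
import Data.Nat.Properties as ℕ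

open import Algebra.Properties.AbelianGroup ℤ.+-0-abelianGroup using (xyx⁻¹≈y)
open import Algebra.Properties.CommutativeSemigroup ℕ.+-commutativeSemigroup using (interchange)
open import Data.Bool using (true; false; if_then_else_; _∧_; _∨_)
open import Data.Fin using (zero; suc)
open import Data.Fin.Subset using (⊤; ⊥; _∪_; _∩_; _─_; _⊆_; _∉_; outside)
open import Data.Fin.Subset.Properties
  using (⊆-antisym; Empty-unique; ∈⊤; x∈p∩q⁻; x∈p∪q⁻; x∈p∪q⁺; x∈p∧x∉q⇒x∈p─q; p─q⊆p)
open import Data.Integer using (_≤_; _+_; _-_; -_)
open import Data.Product using (_,_)
open import Data.Sum using (inj₁; inj₂)
open import Data.Vec using (_∷_; here; there; lookup; tabulate; sum)
open import Data.Vec.Properties using (lookup-zipWith; tabulate-cong)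
open import Function.Bundles using (mk⇔)
open import Relation.Binary.PropositionalEquality using (_≡_; refl; trans; cong; subst; module ≡-Reasoning)

private
  variable
    k n : ℕ

sum-tabulate-+ : (f g : Fin k → ℕ) →
  sum (tabulate λ w → f w ℕ.+ g w) ≡ sum (tabulate f) ℕ.+ sum (tabulate g)
sum-tabulate-+ {ℕ.zero}  f g = refl
sum-tabulate-+ {ℕ.suc k} f g = begin
  f zero ℕ.+ g zero ℕ.+ sum (tabulate λ w → f (suc w) ℕ.+ g (suc w))
    ≡⟨ cong (f zero ℕ.+ g zero ℕ.+_) (sum-tabulate-+ (λ w → f (suc w)) (λ w → g (suc w))) ⟩
  f zero ℕ.+ g zero ℕ.+ (sum (tabulate λ w → f (suc w)) ℕ.+ sum (tabulate λ w → g (suc w)))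
    ≡⟨ interchange (f zero) (g zero) _ _ ⟩
  f zero ℕ.+ sum (tabulate λ w → f (suc w)) ℕ.+ (g zero ℕ.+ sum (tabulate λ w → g (suc w)))
    ∎
  where open ≡-Reasoning

-- deg mult v X is definitionally ∑-over X (mult v).
∑-over : Subset k → (Fin k → ℕ) → ℕ
∑-over X f = sum (tabulate λ w → if lookup X w then f w else 0)

∑-over-⊥ : (f : Fin k → ℕ) → ∑-over ⊥ f ≡ 0
∑-over-⊥ {ℕ.zero}  f = refl
∑-over-⊥ {ℕ.suc k} f = ∑-over-⊥ (λ w → f (suc w))

if-∨-+-if-∧ : ∀ x y (m : ℕ) →
  (if x ∨ y then m else 0) ℕ.+ (if x ∧ y then m else 0) ≡
  (if x then m else 0) ℕ.+ (if y then m else 0)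
if-∨-+-if-∧ true  true  m = refl
if-∨-+-if-∧ true  false m = refl
if-∨-+-if-∧ false true  m = ℕ.+-comm m 0
if-∨-+-if-∧ false false m = refl

∑-over-∪-+-∑-over-∩ : (X Y : Subset k) (f : Fin k → ℕ) →
  ∑-over (X ∪ Y) f ℕ.+ ∑-over (X ∩ Y) f ≡ ∑-over X f ℕ.+ ∑-over Y f
∑-over-∪-+-∑-over-∩ X Y f = begin
  ∑-over (X ∪ Y) f ℕ.+ ∑-over (X ∩ Y) f              ≡⟨ sum-tabulate-+ (term (X ∪ Y)) (term (X ∩ Y)) ⟨
  sum (tabulate λ w → term (X ∪ Y) w ℕ.+ term (X ∩ Y) w) ≡⟨ cong sum (tabulate-cong pointwise) ⟩
  sum (tabulate λ w → term X w ℕ.+ term Y w)             ≡⟨ sum-tabulate-+ (term X) (term Y) ⟩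
  ∑-over X f ℕ.+ ∑-over Y f                              ∎
  where
  open ≡-Reasoning
  term : Subset _ → Fin _ → ℕ
  term Z w = if lookup Z w then f w else 0
  pointwise : ∀ w → term (X ∪ Y) w ℕ.+ term (X ∩ Y) w ≡ term X w ℕ.+ term Y w
  pointwise w rewrite lookup-zipWith _∨_ w X Y | lookup-zipWith _∧_ w X Y =
    if-∨-+-if-∧ (lookup X w) (lookup Y w) (f w)

∑-over-disjoint-∪ : (X Y : Subset k) (f : Fin k → ℕ) → X ∩ Y ≡ ⊥ →
  ∑-over (X ∪ Y) f ≡ ∑-over X f ℕ.+ ∑-over Y f
∑-over-disjoint-∪ X Y f X∩Y≡⊥ = begin
  ∑-over (X ∪ Y) f                        ≡⟨ ℕ.+-identityʳ _ ⟨
  ∑-over (X ∪ Y) f ℕ.+ 0                  ≡⟨ cong (λ Z → ∑-over (X ∪ Y) f ℕ.+ Z) (∑-over-⊥ f) ⟨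
  ∑-over (X ∪ Y) f ℕ.+ ∑-over ⊥ f         ≡⟨ cong (λ Z → ∑-over (X ∪ Y) f ℕ.+ ∑-over Z f) X∩Y≡⊥ ⟨
  ∑-over (X ∪ Y) f ℕ.+ ∑-over (X ∩ Y) f   ≡⟨ ∑-over-∪-+-∑-over-∩ X Y f ⟩
  ∑-over X f ℕ.+ ∑-over Y f               ∎
  where open ≡-Reasoning

x∈p─q⇒x∉q : ∀ {x : Fin n} (p q : Subset n) → x ∈ p ─ q → x ∉ q
x∈p─q⇒x∉q (_ ∷ p) (outside ∷ q) here        ()
x∈p─q⇒x∉q (_ ∷ p) (_       ∷ q) (there x∈p─q) (there x∈q) = x∈p─q⇒x∉q p q x∈p─q x∈q

module _ {A B : Subset n} (part : IsPartition A B) where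

  partition-∈⇒∉ : ∀ {x} → x ∈ A → x ∉ B
  partition-∈⇒∉ {x} x∈A x∈B with part x
  ... | inj₁ (_ , x∉B) = x∉B x∈B
  ... | inj₂ (x∉A , _) = x∉A x∈A

  partition-∩-─ : (S : Subset n) → A ∩ (B ─ S) ≡ ⊥
  partition-∩-─ S = Empty-unique λ where
    (x , x∈A∩B─S) → let x∈A , x∈B─S = x∈p∩q⁻ A (B ─ S) x∈A∩B─S
                    in partition-∈⇒∉ x∈A (p─q⊆p B S x∈B─S)

  partition-∪-─ : {S : Subset n} → S ⊆ B → A ∪ (B ─ S) ≡ ⊤ ─ S
  partition-∪-─ {S} S⊆B = ⊆-antisym ⊆⊤─S ⊤─S⊆
    where
    ⊆⊤─S : A ∪ (B ─ S) ⊆ ⊤ ─ S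
    ⊆⊤─S x∈ with x∈p∪q⁻ A (B ─ S) x∈
    ... | inj₁ x∈A   = x∈p∧x∉q⇒x∈p─q ∈⊤ λ x∈S → partition-∈⇒∉ x∈A (S⊆B x∈S)
    ... | inj₂ x∈B─S = x∈p∧x∉q⇒x∈p─q ∈⊤ (x∈p─q⇒x∉q B S x∈B─S)
    ⊤─S⊆ : ⊤ ─ S ⊆ A ∪ (B ─ S)
    ⊤─S⊆ {x} x∈⊤─S with part x
    ... | inj₁ (x∈A , _) = x∈p∪q⁺ (inj₁ x∈A)
    ... | inj₂ (_ , x∈B) = x∈p∪q⁺ (inj₂ (x∈p∧x∉q⇒x∈p─q x∈B (x∈p─q⇒x∉q ⊤ S x∈⊤─S)))

  deg-complement-split : (mult : Mult n) (v : Fin (ℕ.suc n)) {S : Subset n} → S ⊆ B →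
    deg mult v (withSink (⊤ ─ S)) ≡
    deg mult v (withoutSink A) ℕ.+ deg mult v (withSink (B ─ S))
  deg-complement-split mult v {S} S⊆B = begin
    deg mult v (withSink (⊤ ─ S))
      ≡⟨ cong (λ Z → deg mult v (withSink Z)) (partition-∪-─ S⊆B) ⟨
    deg mult v (withoutSink A ∪ withSink (B ─ S))
      ≡⟨ ∑-over-disjoint-∪ (withoutSink A) (withSink (B ─ S)) (mult v)
           (cong (outside ∷_) (partition-∩-─ S)) ⟩
    deg mult v (withoutSink A) ℕ.+ deg mult v (withSink (B ─ S))
      ∎
    where open ≡-Reasoning

i≤j+k⇒i-j≤k : ∀ {i j k : ℤ} → i ≤ j + k → i - j ≤ k
i≤j+k⇒i-j≤k {i} {j} {k} i≤j+k =
  ℤ.≤-trans (ℤ.+-monoˡ-≤ (- j) i≤j+k) (ℤ.≤-reflexive (xyx⁻¹≈y j k))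

pB-parks : (mult : Mult n) (p : Fin n → ℤ) {A B S : Subset n} → IsPartition A B → S ⊆ B →
  ∀ v → p v ≤ + deg mult (suc v) (withSink (⊤ ─ S)) →
  pB mult p A v ≤ + deg mult (suc v) (withSink (B ─ S))
pB-parks mult p {A} {B} {S} part S⊆B v p≤deg = i≤j+k⇒i-j≤k (subst (p v ≤_) deg-split p≤deg)
  where
  deg-split : + deg mult (suc v) (withSink (⊤ ─ S)) ≡
              + deg mult (suc v) (withoutSink A) + + deg mult (suc v) (withSink (B ─ S))
  deg-split = trans (cong +_ (deg-complement-split part mult (suc v) S⊆B)) (ℤ.pos-+ (deg mult (suc v) (withoutSink A)) _)

proposition2p4 :
    ∀ (n : ℕ) (mult : Mult n) → Symmetric mult → Loopless mult → Connected mult →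
    (p : Fin n → ℤ) → IsPFG mult p →
    (A B : Subset n) → IsPartition A B → Nonempty A → Nonempty B →
    Decomposable mult p A B ⇔
      (IsPF mult A p × (∀ v → v ∈ B → + 0 < pB mult p A v))
proposition2p4 n mult _ _ _ p (_ , p-parks) A B part _ _ = mk⇔
  (λ (pfA , pB-pos , _) → pfA , λ v v∈B → ℤ.suc[i]≤j⇒i<j (pB-pos v v∈B))
  (λ (pfA , pB-pos) → pfA , (λ v v∈B → ℤ.i<j⇒suc[i]≤j (pB-pos v v∈B)) , λ S S⊆B S≢∅ →
     let v , v∈S , p≤deg = p-parks S (λ _ → ∈⊤) S≢∅
     in v , v∈S , pB-parks mult p part S⊆B v p≤deg)
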